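{- Let $\Lambda_1,\Lambda_2$ be $\mathbb Z$-lattices of rank $2m$ on $\mathbb Q$-vector spaces $V_1,V_2$ with non-degenerate alternating bilinear forms, integral on $\Lambda_i$ and of square free levels $N_1,N_2$. Let $\Lambda=\Lambda_1\perp\Lambda_2$ on $V=V_1\perp V_2$, with projections $\pi_i$ onto $\Lambda_i$, and let $X,\hat X$ be maximal totally isotropic submodules of $\Lambda$ such that $\pi_i(X)$ and $\pi_i(\hat X)$ are non-degenerate for $i=1,2$. Let $\phi,\hat\phi:V_1\to V_2$ be the linear maps with $\mathbb QX=\{v+\phi(v):v\in V_1\}$ and $\mathbb Q\hat X=\{v+\hat\phi(v):v\in V_1\}$. Let $W$ be a $2m$-dimensional $\mathbb Q$-vector space with non-degenerate alternating form and $\Sigma_1:V_1\to W$, $\Sigma_2:V_2\to W$ fixed isometries. Then: (a) for $\sigma_1\in Sp(V_1)$, $\sigma_2\in Sp(V_2)$ one has $\mathbb Q\hat X=(\sigma_1,\sigma_2)(\mathbb QX)$ if and only if $\sigma_2\circ\phi\circ\sigma_1^{ -1}=\hat\phi$; (b) $\hat X$ lies in the $Sp(\Lambda_1)\times Sp(\Lambda_2)$-orbit of $X$ if and only if $$\Sigma_2\circ\hat\phi\circ\Sigma_1^{ -1}\in Sp(\Sigma_2\Lambda_2)\,(\Sigma_2\circ\phi\circ\Sigma_1^{ -1})\,Sp(\Sigma_1\Lambda_1).$$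
   Context: For a lattice $L$ on a symplectic space, $Sp(L)$ is the group of isometries preserving $L$; $Sp(\Sigma_i\Lambda_i)\subseteq Sp(W)$. Level of $\Lambda_i$: least $N$ with $N\Lambda_i^\#\subseteq\Lambda_i$, $\Lambda_i^\#$ the dual lattice. The map $\phi$ exists and is unique since both projections of $\mathbb QX$ are all of $V_i$; it satisfies $\langle\phi v,\phi w\rangle=-\langle v,w\rangle$, $\pi_2(X)=\Lambda_2\cap\phi(\Lambda_1)$, $\pi_1(X)=\Lambda_1\cap\phi^{ -1}(\Lambda_2)$; similarly for $\hat\phi$. $(\sigma_1,\sigma_2)$ acts on $V=V_1\perp V_2$ componentwise. -}

module Defs where

open import Data.Nat as ℕ using (ℕ; suc; _≤_)
open import Data.Nat.Divisibility using (_∣_)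
open import Data.Nat.Primality using (Prime)
open import Data.Integer as ℤ using (ℤ)
open import Data.Rational using (ℚ; 0ℚ; _+_; _*_; _/_)
open import Data.Vec using (Vec; []; _∷_; map; zipWith; foldr; replicate)
open import Data.List using (List; []; _∷_)
open import Data.List.Relation.Unary.All using (All)
open import Data.Product using (Σ; ∃; _×_; _,_; proj₁; proj₂)
open import Relation.Binary.PropositionalEquality using (_≡_)
open import Relation.Nullary using (¬_)

Vect : ℕ → Set
Vect n = Vec ℚ n

Mat : ℕ → ℕ → Set
Mat k n = Vec (Vec ℚ n) k

zeroV : ∀ {n} → Vect n
zeroV = replicate _ 0ℚ

infixl 6 _+ᵥ_
_+ᵥ_ : ∀ {n} → Vect n → Vect n → Vect n
_+ᵥ_ = zipWith _+_

infixr 7 _·ᵥ_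
_·ᵥ_ : ∀ {n} → ℚ → Vect n → Vect n
q ·ᵥ v = map (q *_) v

dot : ∀ {n} → Vect n → Vect n → ℚ
dot v w = foldr _ _+_ 0ℚ (zipWith _*_ v w)

apply : ∀ {k n} → Mat k n → Vect n → Vect k
apply M v = map (λ row → dot row v) M

ι : ℤ → ℚ
ι z = z / 1

IsInt : ℚ → Set
IsInt q = ∃ λ (z : ℤ) → q ≡ ι z

form : ∀ {n} → Mat n n → Vect n → Vect n → ℚ
form A v w = dot v (apply A w)

IsAlternating : ∀ {n} → Mat n n → Set
IsAlternating {n} A = (v : Vect n) → form A v v ≡ 0ℚ

IsNonDegenerate : ∀ {n} → Mat n n → Set
IsNonDegenerate {n} A = (v : Vect n) → ((w : Vect n) → form A v w ≡ 0ℚ) → v ≡ zeroV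

IsSymplectic : ∀ {n} → Mat n n → Set
IsSymplectic A = IsAlternating A × IsNonDegenerate A

-- Linear isometries (bijective linear maps preserving the forms).
-- Sp(V) = Isometry A A.

record Isometry {n} (A : Mat n n) (A' : Mat n n) : Set where
  field
    mat     : Mat n n
    inv     : Mat n n
    inv-l   : (v : Vect n) → apply inv (apply mat v) ≡ v
    inv-r   : (v : Vect n) → apply mat (apply inv v) ≡ v
    isom    : (v w : Vect n) → form A' (apply mat v) (apply mat w) ≡ form A v w
open Isometry public

⟦_⟧ : ∀ {n} {A A' : Mat n n} → Isometry A A' → Vect n → Vect n
⟦ σ ⟧ = apply (mat σ)

⟦_⟧⁻¹ : ∀ {n} {A A' : Mat n n} → Isometry A A' → Vect n → Vect n
⟦ σ ⟧⁻¹ = apply (inv σ)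

Subset : ℕ → Set₁
Subset n = Vect n → Set

_⊆_ : ∀ {n} → Subset n → Subset n → Set
S ⊆ T = ∀ v → S v → T v

_≐_ : ∀ {n} → Subset n → Subset n → Set
S ≐ T = (S ⊆ T) × (T ⊆ S)

lincomb : ∀ {k n} → Vec ℚ k → Vec (Vect n) k → Vect n
lincomb cs bs = foldr _ _+ᵥ_ zeroV (zipWith _·ᵥ_ cs bs)

LinIndep : ∀ {k n} → Vec (Vect n) k → Set
LinIndep {k} bs = (cs : Vec ℚ k) → lincomb cs bs ≡ zeroV → cs ≡ replicate _ 0ℚ

record Lattice (n : ℕ) : Set where
  field
    basis   : Vec (Vect n) n
    indep   : LinIndep basis
open Lattice public

_∈L_ : ∀ {n} → Vect n → Lattice n → Set
v ∈L L = ∃ λ (cs : Vec ℤ _) → v ≡ lincomb (map ι cs) (basis L)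

IsIntegralOn : ∀ {n} → Mat n n → Lattice n → Set
IsIntegralOn A L = ∀ x y → x ∈L L → y ∈L L → IsInt (form A x y)

Dual : ∀ {n} → Mat n n → Lattice n → Subset n
Dual A L v = ∀ x → x ∈L L → IsInt (form A v x)

Annihilates : ∀ {n} → Mat n n → Lattice n → ℕ → Set
Annihilates A L N = ∀ v → Dual A L v → (ι (ℤ.+ N) ·ᵥ v) ∈L L

IsLevel : ∀ {n} → Mat n n → Lattice n → ℕ → Set
IsLevel A L N = (1 ≤ N) × Annihilates A L N × (∀ M → 1 ≤ M → Annihilates A L M → N ≤ M)

SquareFree : ℕ → Set
SquareFree N = ∀ p → Prime p → ¬ (p ℕ.* p ∣ N)

-- Sp(L): isometries of (ℚ^n, A) mapping the lattice-subset L onto itself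
PreservesSet : ∀ {n} {A : Mat n n} → Isometry A A → Subset n → Set
PreservesSet σ L = (∀ v → L v → L (⟦ σ ⟧ v)) × (∀ v → L v → L (⟦ σ ⟧⁻¹ v))

⟪_⟫ : ∀ {n} → Lattice n → Subset n
⟪ L ⟫ v = v ∈L L

img : ∀ {n} {A A' : Mat n n} → Isometry A A' → Subset n → Subset n
img σ S w = ∃ λ v → S v × w ≡ ⟦ σ ⟧ v

-- The orthogonal sum V = V₁ ⊥ V₂, elements are pairs.

V² : ℕ → Set
V² n = Vect n × Vect n

Subset² : ℕ → Set₁
Subset² n = V² n → Set

_⊆²_ : ∀ {n} → Subset² n → Subset² n → Set
S ⊆² T = ∀ v → S v → T v

_≐²_ : ∀ {n} → Subset² n → Subset² n → Set
S ≐² T = (S ⊆² T) × (T ⊆² S)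

form² : ∀ {n} → Mat n n → Mat n n → V² n → V² n → ℚ
form² A₁ A₂ (v₁ , v₂) (w₁ , w₂) = form A₁ v₁ w₁ + form A₂ v₂ w₂

LatSum : ∀ {n} → Lattice n → Lattice n → Subset² n
LatSum L₁ L₂ (v₁ , v₂) = (v₁ ∈L L₁) × (v₂ ∈L L₂)

record IsSubmodule {n} (X : Subset² n) : Set where
  field
    has-zero : X (zeroV , zeroV)
    closed-+ : ∀ {v₁ v₂ w₁ w₂} → X (v₁ , v₂) → X (w₁ , w₂) → X (v₁ +ᵥ w₁ , v₂ +ᵥ w₂)
    closed-ℤ : ∀ (z : ℤ) {v₁ v₂} → X (v₁ , v₂) → X (ι z ·ᵥ v₁ , ι z ·ᵥ v₂)

IsTotallyIsotropic : ∀ {n} → Mat n n → Mat n n → Subset² n → Set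
IsTotallyIsotropic A₁ A₂ X = ∀ x y → X x → X y → form² A₁ A₂ x y ≡ 0ℚ

IsTISubmodule : ∀ {n} → Mat n n → Mat n n → Subset² n → Subset² n → Set
IsTISubmodule A₁ A₂ Λ X = IsSubmodule X × (X ⊆² Λ) × IsTotallyIsotropic A₁ A₂ X

IsMaxTISubmodule : ∀ {n} → Mat n n → Mat n n → Subset² n → Subset² n → Set₁
IsMaxTISubmodule A₁ A₂ Λ X =
  IsTISubmodule A₁ A₂ Λ X × (∀ Y → IsTISubmodule A₁ A₂ Λ Y → X ⊆² Y → Y ⊆² X)

π₁ : ∀ {n} → Subset² n → Subset n
π₁ X v₁ = ∃ λ v₂ → X (v₁ , v₂)

π₂ : ∀ {n} → Subset² n → Subset n
π₂ X v₂ = ∃ λ v₁ → X (v₁ , v₂)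

NonDegOn : ∀ {n} → Mat n n → Subset n → Set
NonDegOn A S = ∀ x → S x → (∀ y → S y → form A x y ≡ 0ℚ) → x ≡ zeroV

lincomb² : ∀ {n} → List (ℚ × V² n) → V² n
lincomb² [] = zeroV , zeroV
lincomb² ((q , (x₁ , x₂)) ∷ xs) =
  let (s₁ , s₂) = lincomb² xs in (q ·ᵥ x₁ +ᵥ s₁) , (q ·ᵥ x₂ +ᵥ s₂)

Span : ∀ {n} → Subset² n → Subset² n
Span X v = ∃ λ (xs : List (ℚ × V² _)) → All (λ p → X (proj₂ p)) xs × v ≡ lincomb² xs

Graph : ∀ {n} → Mat n n → Subset² n
Graph φ (v₁ , v₂) = v₂ ≡ apply φ v₁

img² : ∀ {n} {A₁ A₂ : Mat n n} → Isometry A₁ A₁ → Isometry A₂ A₂ → Subset² n → Subset² n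
img² σ₁ σ₂ S (w₁ , w₂) = ∃ λ v → S v × (w₁ ≡ ⟦ σ₁ ⟧ (proj₁ v)) × (w₂ ≡ ⟦ σ₂ ⟧ (proj₂ v))

{-# OPTIONS --safe #-}
-- Everything is read off the graph description ℚX = {(v , φ v)}.
-- (a) (σ₁, σ₂) maps the graph of φ onto the graph of φ̂ exactly when σ₂ ∘ φ ∘ σ₁⁻¹ = φ̂.
-- (b) A maximal totally isotropic X equals ℚX ∩ Λ, because ℚX ∩ Λ is again a totally isotropic
-- submodule of Λ containing X. So for (σ₁, σ₂) ∈ Sp(Λ₁) × Sp(Λ₂), mapping X onto X̂ is the same as
-- mapping ℚX onto ℚX̂, i.e. the condition of (a); conjugating by Σᵢ (τ₂ = Σ₂σ₂Σ₂⁻¹, τ₁ = Σ₁σ₁⁻¹Σ₁⁻¹)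
-- turns this into the double coset condition in W.
module Submission where

open import Defs
open import Algebra.Bundles using (CommutativeMonoid)
open import Data.Nat using (ℕ; zero; suc; _*_)
open import Data.Integer as ℤ using (ℤ)
import Data.Integer.Properties as ℤ
open import Data.Rational as ℚ using (ℚ; 0ℚ; 1ℚ; _+_; fromℚᵘ)
open import Data.Rational.Properties
  using ( +-identityˡ; +-identityʳ; *-assoc; *-comm; *-identityˡ; *-zeroˡ; *-zeroʳ
        ; *-distribˡ-+; *-distribʳ-+; +-0-commutativeMonoid
        ; toℚᵘ-injective; toℚᵘ-fromℚᵘ; toℚᵘ-homo-+; toℚᵘ-homo-*; fromℚᵘ-cong )
import Data.Rational.Unnormalised as ℚᵘ
import Data.Rational.Unnormalised.Properties as ℚᵘ
open import Algebra.Properties.CommutativeSemigroup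
  (CommutativeMonoid.commutativeSemigroup +-0-commutativeMonoid) using (interchange)
open import Data.Vec using (Vec; []; _∷_; map; zipWith; replicate)
open import Data.Vec.Properties using (zipWith-identityˡ; zipWith-identityʳ; map-replicate; map-∘; map-cong)
open import Data.List as List using (List; []; _∷_)
open import Data.List.Relation.Unary.All as All using (All; []; _∷_)
open import Data.List.Relation.Unary.All.Properties using (map⁺)
open import Data.Product using (Σ; _×_; _,_; proj₁; proj₂; map₂)
open import Function using (_∘_)
open import Function.Bundles using (_⇔_; mk⇔; Equivalence)
import Function.Properties.Equivalence as ⇔
open import Level using (0ℓ) renaming (suc to lsuc)
open import Relation.Binary.Bundles using (Setoid)
import Relation.Binary.Reasoning.Setoid
open import Relation.Binary.PropositionalEquality

private variable
  k l n : ℕ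

ιᵘ : ℤ → ℚᵘ.ℚᵘ
ιᵘ z = ℚᵘ.mkℚᵘ z 0

fromℚᵘ-homo-+ : ∀ p q → fromℚᵘ (p ℚᵘ.+ q) ≡ fromℚᵘ p + fromℚᵘ q
fromℚᵘ-homo-+ p q = toℚᵘ-injective (ℚᵘ.≃-trans (toℚᵘ-fromℚᵘ (p ℚᵘ.+ q))
  (ℚᵘ.≃-sym (ℚᵘ.≃-trans (toℚᵘ-homo-+ (fromℚᵘ p) (fromℚᵘ q))
                         (ℚᵘ.+-cong (toℚᵘ-fromℚᵘ p) (toℚᵘ-fromℚᵘ q)))))

fromℚᵘ-homo-* : ∀ p q → fromℚᵘ (p ℚᵘ.* q) ≡ fromℚᵘ p ℚ.* fromℚᵘ q
fromℚᵘ-homo-* p q = toℚᵘ-injective (ℚᵘ.≃-trans (toℚᵘ-fromℚᵘ (p ℚᵘ.* q))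
  (ℚᵘ.≃-sym (ℚᵘ.≃-trans (toℚᵘ-homo-* (fromℚᵘ p) (fromℚᵘ q))
                         (ℚᵘ.*-cong (toℚᵘ-fromℚᵘ p) (toℚᵘ-fromℚᵘ q)))))

-- ι z is definitionally fromℚᵘ (ιᵘ z), and ιᵘ respects + and * up to ≃.
ι-+ : ∀ a b → ι (a ℤ.+ b) ≡ ι a + ι b
ι-+ a b = trans (fromℚᵘ-cong {ιᵘ (a ℤ.+ b)} {ιᵘ a ℚᵘ.+ ιᵘ b} (ℚᵘ.*≡* denominators-one))
                (fromℚᵘ-homo-+ (ιᵘ a) (ιᵘ b))
  where
  denominators-one : (a ℤ.+ b) ℤ.* ℤ.+ 1 ≡ (a ℤ.* ℤ.+ 1 ℤ.+ b ℤ.* ℤ.+ 1) ℤ.* ℤ.+ 1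
  denominators-one = cong (ℤ._* ℤ.+ 1) (sym (cong₂ ℤ._+_ (ℤ.*-identityʳ a) (ℤ.*-identityʳ b)))

ι-* : ∀ a b → ι (a ℤ.* b) ≡ ι a ℚ.* ι b
ι-* a b = fromℚᵘ-homo-* (ιᵘ a) (ιᵘ b)

+ᵥ-identityˡ : (v : Vect n) → zeroV +ᵥ v ≡ v
+ᵥ-identityˡ = zipWith-identityˡ +-identityˡ

+ᵥ-identityʳ : (v : Vect n) → v +ᵥ zeroV ≡ v
+ᵥ-identityʳ = zipWith-identityʳ +-identityʳ

+ᵥ-interchange : (a b c d : Vect n) → (a +ᵥ b) +ᵥ (c +ᵥ d) ≡ (a +ᵥ c) +ᵥ (b +ᵥ d)
+ᵥ-interchange [] [] [] [] = refl
+ᵥ-interchange (a ∷ as) (b ∷ bs) (c ∷ cs) (d ∷ ds) =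
  cong₂ _∷_ (interchange a b c d) (+ᵥ-interchange as bs cs ds)

·ᵥ-distribˡ : ∀ q (u v : Vect n) → q ·ᵥ (u +ᵥ v) ≡ q ·ᵥ u +ᵥ q ·ᵥ v
·ᵥ-distribˡ q [] [] = refl
·ᵥ-distribˡ q (a ∷ u) (b ∷ v) = cong₂ _∷_ (*-distribˡ-+ q a b) (·ᵥ-distribˡ q u v)

·ᵥ-distribʳ : ∀ p q (v : Vect n) → (p + q) ·ᵥ v ≡ p ·ᵥ v +ᵥ q ·ᵥ v
·ᵥ-distribʳ p q [] = refl
·ᵥ-distribʳ p q (a ∷ v) = cong₂ _∷_ (*-distribʳ-+ a p q) (·ᵥ-distribʳ p q v)

·ᵥ-assoc : ∀ p q (v : Vect n) → (p ℚ.* q) ·ᵥ v ≡ p ·ᵥ (q ·ᵥ v)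
·ᵥ-assoc p q [] = refl
·ᵥ-assoc p q (a ∷ v) = cong₂ _∷_ (*-assoc p q a) (·ᵥ-assoc p q v)

·ᵥ-identityˡ : (v : Vect n) → 1ℚ ·ᵥ v ≡ v
·ᵥ-identityˡ [] = refl
·ᵥ-identityˡ (a ∷ v) = cong₂ _∷_ (*-identityˡ a) (·ᵥ-identityˡ v)

·ᵥ-zeroˡ : (v : Vect n) → 0ℚ ·ᵥ v ≡ zeroV
·ᵥ-zeroˡ [] = refl
·ᵥ-zeroˡ (a ∷ v) = cong₂ _∷_ (*-zeroˡ a) (·ᵥ-zeroˡ v)

·ᵥ-zeroʳ : ∀ q → q ·ᵥ zeroV {n} ≡ zeroV
·ᵥ-zeroʳ {zero} q = refl
·ᵥ-zeroʳ {suc n} q = cong₂ _∷_ (*-zeroʳ q) (·ᵥ-zeroʳ q)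

dot-+ˡ : (u v w : Vect n) → dot (u +ᵥ v) w ≡ dot u w + dot v w
dot-+ˡ [] [] [] = sym (+-identityˡ 0ℚ)
dot-+ˡ (a ∷ u) (b ∷ v) (c ∷ w) = begin
  (a + b) ℚ.* c + dot (u +ᵥ v) w              ≡⟨ cong₂ _+_ (*-distribʳ-+ c a b) (dot-+ˡ u v w) ⟩
  (a ℚ.* c + b ℚ.* c) + (dot u w + dot v w)   ≡⟨ interchange (a ℚ.* c) (b ℚ.* c) (dot u w) (dot v w) ⟩
  (a ℚ.* c + dot u w) + (b ℚ.* c + dot v w)   ∎
  where open ≡-Reasoning

dot-·ˡ : ∀ q (u w : Vect n) → dot (q ·ᵥ u) w ≡ q ℚ.* dot u w
dot-·ˡ q [] [] = sym (*-zeroʳ q)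
dot-·ˡ q (a ∷ u) (c ∷ w) = begin
  q ℚ.* a ℚ.* c + dot (q ·ᵥ u) w     ≡⟨ cong₂ _+_ (*-assoc q a c) (dot-·ˡ q u w) ⟩
  q ℚ.* (a ℚ.* c) + q ℚ.* dot u w    ≡⟨ *-distribˡ-+ q _ _ ⟨
  q ℚ.* (a ℚ.* c + dot u w)          ∎
  where open ≡-Reasoning

dot-zeroˡ : (w : Vect n) → dot zeroV w ≡ 0ℚ
dot-zeroˡ [] = refl
dot-zeroˡ (c ∷ w) = trans (cong₂ _+_ (*-zeroˡ c) (dot-zeroˡ w)) (+-identityˡ 0ℚ)

dot-comm : (u w : Vect n) → dot u w ≡ dot w u
dot-comm [] [] = refl
dot-comm (a ∷ u) (c ∷ w) = cong₂ _+_ (*-comm a c) (dot-comm u w)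

dot-+ʳ : (u v w : Vect n) → dot u (v +ᵥ w) ≡ dot u v + dot u w
dot-+ʳ u v w = begin
  dot u (v +ᵥ w)        ≡⟨ dot-comm u _ ⟩
  dot (v +ᵥ w) u        ≡⟨ dot-+ˡ v w u ⟩
  dot v u + dot w u     ≡⟨ cong₂ _+_ (dot-comm v u) (dot-comm w u) ⟩
  dot u v + dot u w     ∎
  where open ≡-Reasoning

dot-·ʳ : ∀ q (u w : Vect n) → dot u (q ·ᵥ w) ≡ q ℚ.* dot u w
dot-·ʳ q u w = trans (dot-comm u _) (trans (dot-·ˡ q w u) (cong (q ℚ.*_) (dot-comm w u)))

dot-zeroʳ : (w : Vect n) → dot w zeroV ≡ 0ℚ
dot-zeroʳ w = trans (dot-comm w _) (dot-zeroˡ w)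

apply-+ : (M : Mat k n) (u v : Vect n) → apply M (u +ᵥ v) ≡ apply M u +ᵥ apply M v
apply-+ [] u v = refl
apply-+ (r ∷ M) u v = cong₂ _∷_ (dot-+ʳ r u v) (apply-+ M u v)

apply-· : (M : Mat k n) (q : ℚ) (u : Vect n) → apply M (q ·ᵥ u) ≡ q ·ᵥ apply M u
apply-· [] q u = refl
apply-· (r ∷ M) q u = cong₂ _∷_ (dot-·ʳ q r u) (apply-· M q u)

apply-zero : (M : Mat k n) → apply M zeroV ≡ zeroV
apply-zero [] = refl
apply-zero (r ∷ M) = cong₂ _∷_ (dot-zeroʳ r) (apply-zero M)

form-+ˡ : (A : Mat n n) (u v w : Vect n) → form A (u +ᵥ v) w ≡ form A u w + form A v w
form-+ˡ A u v w = dot-+ˡ u v (apply A w)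

form-·ˡ : (A : Mat n n) (q : ℚ) (u w : Vect n) → form A (q ·ᵥ u) w ≡ q ℚ.* form A u w
form-·ˡ A q u w = dot-·ˡ q u (apply A w)

form-zeroˡ : (A : Mat n n) (w : Vect n) → form A zeroV w ≡ 0ℚ
form-zeroˡ A w = dot-zeroˡ (apply A w)

form-+ʳ : (A : Mat n n) (u v w : Vect n) → form A u (v +ᵥ w) ≡ form A u v + form A u w
form-+ʳ A u v w = trans (cong (dot u) (apply-+ A v w)) (dot-+ʳ u _ _)

form-·ʳ : (A : Mat n n) (q : ℚ) (u w : Vect n) → form A u (q ·ᵥ w) ≡ q ℚ.* form A u w
form-·ʳ A q u w = trans (cong (dot u) (apply-· A q w)) (dot-·ʳ q u _)

form-zeroʳ : (A : Mat n n) (u : Vect n) → form A u zeroV ≡ 0ℚ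
form-zeroʳ A u = trans (cong (dot u) (apply-zero A)) (dot-zeroʳ u)

lincomb-+ : (as bs : Vec ℚ k) (B : Vec (Vect n) k) →
            lincomb (zipWith _+_ as bs) B ≡ lincomb as B +ᵥ lincomb bs B
lincomb-+ [] [] [] = sym (+ᵥ-identityˡ zeroV)
lincomb-+ (a ∷ as) (b ∷ bs) (x ∷ B) = begin
  (a + b) ·ᵥ x +ᵥ lincomb (zipWith _+_ as bs) B
    ≡⟨ cong₂ _+ᵥ_ (·ᵥ-distribʳ a b x) (lincomb-+ as bs B) ⟩
  (a ·ᵥ x +ᵥ b ·ᵥ x) +ᵥ (lincomb as B +ᵥ lincomb bs B)
    ≡⟨ +ᵥ-interchange _ _ _ _ ⟩
  (a ·ᵥ x +ᵥ lincomb as B) +ᵥ (b ·ᵥ x +ᵥ lincomb bs B) ∎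
  where open ≡-Reasoning

lincomb-· : ∀ q (as : Vec ℚ k) (B : Vec (Vect n) k) → lincomb (map (q ℚ.*_) as) B ≡ q ·ᵥ lincomb as B
lincomb-· q [] [] = sym (·ᵥ-zeroʳ q)
lincomb-· q (a ∷ as) (x ∷ B) =
  trans (cong₂ _+ᵥ_ (·ᵥ-assoc q a x) (lincomb-· q as B)) (sym (·ᵥ-distribˡ q _ _))

lincomb-zero : (B : Vec (Vect n) k) → lincomb (replicate k 0ℚ) B ≡ zeroV
lincomb-zero [] = refl
lincomb-zero (x ∷ B) = trans (cong₂ _+ᵥ_ (·ᵥ-zeroˡ x) (lincomb-zero B)) (+ᵥ-identityˡ zeroV)

dot-lincomb : (cs : Vec ℚ k) (B : Vec (Vect n) k) (v : Vect n) → dot (lincomb cs B) v ≡ dot cs (apply B v)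
dot-lincomb [] [] v = dot-zeroˡ v
dot-lincomb (c ∷ cs) (x ∷ B) v =
  trans (dot-+ˡ (c ·ᵥ x) (lincomb cs B) v) (cong₂ _+_ (dot-·ˡ c x v) (dot-lincomb cs B v))

_⊗_ : Mat k l → Mat l n → Mat k n
M ⊗ N = map (λ row → lincomb row N) M

apply-⊗ : (M : Mat k l) (N : Mat l n) (v : Vect n) → apply (M ⊗ N) v ≡ apply M (apply N v)
apply-⊗ [] N v = refl
apply-⊗ (r ∷ M) N v = cong₂ _∷_ (dot-lincomb r N v) (apply-⊗ M N v)

map-ι-+ : (cs ds : Vec ℤ k) → map ι (zipWith ℤ._+_ cs ds) ≡ zipWith _+_ (map ι cs) (map ι ds)
map-ι-+ [] [] = refl
map-ι-+ (c ∷ cs) (d ∷ ds) = cong₂ _∷_ (ι-+ c d) (map-ι-+ cs ds)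

map-ι-* : ∀ z (cs : Vec ℤ k) → map ι (map (z ℤ.*_) cs) ≡ map (ι z ℚ.*_) (map ι cs)
map-ι-* z cs = trans (sym (map-∘ ι (z ℤ.*_) cs)) (trans (map-cong (ι-* z) cs) (map-∘ (ι z ℚ.*_) ι cs))

∈L-zero : (L : Lattice n) → zeroV ∈L L
∈L-zero {n} L = replicate n (ℤ.+ 0) ,
  sym (trans (cong (λ cs → lincomb cs (basis L)) (map-replicate ι (ℤ.+ 0) n)) (lincomb-zero (basis L)))

∈L-+ : (L : Lattice n) {v w : Vect n} → v ∈L L → w ∈L L → (v +ᵥ w) ∈L L
∈L-+ L (cs , refl) (ds , refl) = zipWith ℤ._+_ cs ds ,
  sym (trans (cong (λ es → lincomb es (basis L)) (map-ι-+ cs ds)) (lincomb-+ (map ι cs) (map ι ds) (basis L)))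

∈L-ℤ· : (L : Lattice n) (z : ℤ) {v : Vect n} → v ∈L L → (ι z ·ᵥ v) ∈L L
∈L-ℤ· L z (cs , refl) = map (z ℤ.*_) cs ,
  sym (trans (cong (λ es → lincomb es (basis L)) (map-ι-* z cs)) (lincomb-· (ι z) (map ι cs) (basis L)))

invᴵ : {A A' : Mat n n} → Isometry A A' → Isometry A' A
invᴵ {A' = A'} σ = record
  { mat = inv σ ; inv = mat σ ; inv-l = inv-r σ ; inv-r = inv-l σ
  ; isom = λ v w → trans (sym (isom σ (⟦ σ ⟧⁻¹ v) (⟦ σ ⟧⁻¹ w))) (cong₂ (form A') (inv-r σ v) (inv-r σ w)) }

infixr 9 _∘ᴵ_
_∘ᴵ_ : {A B C : Mat n n} → Isometry B C → Isometry A B → Isometry A C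
_∘ᴵ_ {C = C} g f = record
  { mat = mat g ⊗ mat f ; inv = inv f ⊗ inv g
  ; inv-l = λ v → begin
      apply (inv f ⊗ inv g) (apply (mat g ⊗ mat f) v) ≡⟨ apply-⊗ (inv f) (inv g) _ ⟩
      ⟦ f ⟧⁻¹ (⟦ g ⟧⁻¹ (apply (mat g ⊗ mat f) v))     ≡⟨ cong (⟦ f ⟧⁻¹ ∘ ⟦ g ⟧⁻¹) (apply-⊗ (mat g) (mat f) v) ⟩
      ⟦ f ⟧⁻¹ (⟦ g ⟧⁻¹ (⟦ g ⟧ (⟦ f ⟧ v)))              ≡⟨ cong ⟦ f ⟧⁻¹ (inv-l g _) ⟩
      ⟦ f ⟧⁻¹ (⟦ f ⟧ v)                                ≡⟨ inv-l f v ⟩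
      v ∎
  ; inv-r = λ v → begin
      apply (mat g ⊗ mat f) (apply (inv f ⊗ inv g) v) ≡⟨ apply-⊗ (mat g) (mat f) _ ⟩
      ⟦ g ⟧ (⟦ f ⟧ (apply (inv f ⊗ inv g) v))         ≡⟨ cong (⟦ g ⟧ ∘ ⟦ f ⟧) (apply-⊗ (inv f) (inv g) v) ⟩
      ⟦ g ⟧ (⟦ f ⟧ (⟦ f ⟧⁻¹ (⟦ g ⟧⁻¹ v)))              ≡⟨ cong ⟦ g ⟧ (inv-r f _) ⟩
      ⟦ g ⟧ (⟦ g ⟧⁻¹ v)                                ≡⟨ inv-r g v ⟩
      v ∎
  ; isom = λ v w → trans (cong₂ (form C) (apply-⊗ (mat g) (mat f) v) (apply-⊗ (mat g) (mat f) w))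
                         (trans (isom g _ _) (isom f v w)) }
  where open ≡-Reasoning

conj : {A A' : Mat n n} → Isometry A A' → Isometry A A → Isometry A' A'
conj S σ = S ∘ᴵ σ ∘ᴵ invᴵ S

⟦conj⟧ : {A A' : Mat n n} (S : Isometry A A') (σ : Isometry A A) →
         ∀ w → ⟦ conj S σ ⟧ w ≡ ⟦ S ⟧ (⟦ σ ⟧ (⟦ S ⟧⁻¹ w))
⟦conj⟧ S σ w = trans (apply-⊗ (mat S) _ w) (cong ⟦ S ⟧ (apply-⊗ (mat σ) (inv S) w))

⟦conj⟧⁻¹ : {A A' : Mat n n} (S : Isometry A A') (σ : Isometry A A) →
           ∀ w → ⟦ conj S σ ⟧⁻¹ w ≡ ⟦ S ⟧ (⟦ σ ⟧⁻¹ (⟦ S ⟧⁻¹ w))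
⟦conj⟧⁻¹ S σ w = trans (apply-⊗ (mat S ⊗ inv σ) (inv S) w) (apply-⊗ (mat S) (inv σ) _)

PreservesSet-invᴵ : {A : Mat n n} (σ : Isometry A A) {P : Subset n} → PreservesSet σ P → PreservesSet (invᴵ σ) P
PreservesSet-invᴵ σ (to , from) = from , to

PreservesSet-conj : {A A' : Mat n n} (S : Isometry A A') (σ : Isometry A A) {P : Subset n} →
                    PreservesSet σ P → PreservesSet (conj S σ) (img S P)
PreservesSet-conj S σ (to , from) =
  (λ { _ (v , pv , refl) → ⟦ σ ⟧ v , to v pv ,
         trans (⟦conj⟧ S σ _) (cong (⟦ S ⟧ ∘ ⟦ σ ⟧) (inv-l S v)) }) ,
  (λ { _ (v , pv , refl) → ⟦ σ ⟧⁻¹ v , from v pv ,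
         trans (⟦conj⟧⁻¹ S σ _) (cong (⟦ S ⟧ ∘ ⟦ σ ⟧⁻¹) (inv-l S v)) })

PreservesSet-unconj : {A A' : Mat n n} (S : Isometry A A') (τ : Isometry A' A') {P : Subset n} →
                      PreservesSet τ (img S P) → PreservesSet (conj (invᴵ S) τ) P
PreservesSet-unconj S τ {P} (to , from) =
  (λ v pv → pull (⟦conj⟧ (invᴵ S) τ v) (to (⟦ S ⟧ v) (v , pv , refl))) ,
  (λ v pv → pull (⟦conj⟧⁻¹ (invᴵ S) τ v) (from (⟦ S ⟧ v) (v , pv , refl)))
  where
  pull : ∀ {u w} → u ≡ ⟦ S ⟧⁻¹ w → img S P w → P u
  pull refl (v , pv , refl) = subst P (sym (inv-l S v)) pv

infixl 6 _+²_
_+²_ : V² n → V² n → V² n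
(u₁ , u₂) +² (v₁ , v₂) = u₁ +ᵥ v₁ , u₂ +ᵥ v₂

infixr 7 _·²_
_·²_ : ℚ → V² n → V² n
q ·² (v₁ , v₂) = q ·ᵥ v₁ , q ·ᵥ v₂

apply² : Mat n n → Mat n n → V² n → V² n
apply² M₁ M₂ (v₁ , v₂) = apply M₁ v₁ , apply M₂ v₂

apply²-lincomb² : (M₁ M₂ : Mat n n) (xs : List (ℚ × V² n)) →
                  apply² M₁ M₂ (lincomb² xs) ≡ lincomb² (List.map (map₂ (apply² M₁ M₂)) xs)
apply²-lincomb² M₁ M₂ [] = cong₂ _,_ (apply-zero M₁) (apply-zero M₂)
apply²-lincomb² M₁ M₂ ((q , (x₁ , x₂)) ∷ xs) = cong₂ _,_
  (trans (apply-+ M₁ _ _) (cong₂ _+ᵥ_ (apply-· M₁ q x₁) (cong proj₁ (apply²-lincomb² M₁ M₂ xs))))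
  (trans (apply-+ M₂ _ _) (cong₂ _+ᵥ_ (apply-· M₂ q x₂) (cong proj₂ (apply²-lincomb² M₁ M₂ xs))))

module _ (A₁ A₂ : Mat n n) where

  form²-+ˡ : (u v w : V² n) → form² A₁ A₂ (u +² v) w ≡ form² A₁ A₂ u w + form² A₁ A₂ v w
  form²-+ˡ (u₁ , u₂) (v₁ , v₂) (w₁ , w₂) =
    trans (cong₂ _+_ (form-+ˡ A₁ u₁ v₁ w₁) (form-+ˡ A₂ u₂ v₂ w₂))
          (interchange (form A₁ u₁ w₁) (form A₁ v₁ w₁) (form A₂ u₂ w₂) (form A₂ v₂ w₂))

  form²-+ʳ : (u v w : V² n) → form² A₁ A₂ u (v +² w) ≡ form² A₁ A₂ u v + form² A₁ A₂ u w
  form²-+ʳ (u₁ , u₂) (v₁ , v₂) (w₁ , w₂) =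
    trans (cong₂ _+_ (form-+ʳ A₁ u₁ v₁ w₁) (form-+ʳ A₂ u₂ v₂ w₂))
          (interchange (form A₁ u₁ v₁) (form A₁ u₁ w₁) (form A₂ u₂ v₂) (form A₂ u₂ w₂))

  form²-·ˡ : ∀ q (u w : V² n) → form² A₁ A₂ (q ·² u) w ≡ q ℚ.* form² A₁ A₂ u w
  form²-·ˡ q (u₁ , u₂) (w₁ , w₂) =
    trans (cong₂ _+_ (form-·ˡ A₁ q u₁ w₁) (form-·ˡ A₂ q u₂ w₂)) (sym (*-distribˡ-+ q _ _))

  form²-·ʳ : ∀ q (u w : V² n) → form² A₁ A₂ u (q ·² w) ≡ q ℚ.* form² A₁ A₂ u w
  form²-·ʳ q (u₁ , u₂) (w₁ , w₂) =
    trans (cong₂ _+_ (form-·ʳ A₁ q u₁ w₁) (form-·ʳ A₂ q u₂ w₂)) (sym (*-distribˡ-+ q _ _))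

  form²-zeroˡ : (w : V² n) → form² A₁ A₂ (zeroV , zeroV) w ≡ 0ℚ
  form²-zeroˡ (w₁ , w₂) = trans (cong₂ _+_ (form-zeroˡ A₁ w₁) (form-zeroˡ A₂ w₂)) (+-identityʳ 0ℚ)

  form²-zeroʳ : (u : V² n) → form² A₁ A₂ u (zeroV , zeroV) ≡ 0ℚ
  form²-zeroʳ (u₁ , u₂) = trans (cong₂ _+_ (form-zeroʳ A₁ u₁) (form-zeroʳ A₂ u₂)) (+-identityʳ 0ℚ)

  private
    q*0+0≡0 : ∀ q {a b} → a ≡ 0ℚ → b ≡ 0ℚ → q ℚ.* a + b ≡ 0ℚ
    q*0+0≡0 q refl refl = trans (cong (_+ 0ℚ) (*-zeroʳ q)) (+-identityʳ 0ℚ)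

  lincomb²-orthogonalˡ : {P : Subset² n} (y : V² n) → (∀ x → P x → form² A₁ A₂ x y ≡ 0ℚ) →
                         ∀ xs → All (P ∘ proj₂) xs → form² A₁ A₂ (lincomb² xs) y ≡ 0ℚ
  lincomb²-orthogonalˡ y x⊥y [] [] = form²-zeroˡ y
  lincomb²-orthogonalˡ y x⊥y ((q , x) ∷ xs) (px ∷ pxs) =
    trans (form²-+ˡ (q ·² x) (lincomb² xs) y)
          (trans (cong (_+ _) (form²-·ˡ q x y))
                 (q*0+0≡0 q (x⊥y x px) (lincomb²-orthogonalˡ y x⊥y xs pxs)))

  lincomb²-orthogonalʳ : {P : Subset² n} (y : V² n) → (∀ x → P x → form² A₁ A₂ y x ≡ 0ℚ) →
                         ∀ xs → All (P ∘ proj₂) xs → form² A₁ A₂ y (lincomb² xs) ≡ 0ℚ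
  lincomb²-orthogonalʳ y y⊥x [] [] = form²-zeroʳ y
  lincomb²-orthogonalʳ y y⊥x ((q , x) ∷ xs) (px ∷ pxs) =
    trans (form²-+ʳ y (q ·² x) (lincomb² xs))
          (trans (cong (_+ _) (form²-·ʳ q y x))
                 (q*0+0≡0 q (y⊥x x px) (lincomb²-orthogonalʳ y y⊥x xs pxs)))

  Span-isTotallyIsotropic : {X : Subset² n} → IsTotallyIsotropic A₁ A₂ X → IsTotallyIsotropic A₁ A₂ (Span X)
  Span-isTotallyIsotropic isoX _ _ (xs , pxs , refl) (ys , pys , refl) =
    lincomb²-orthogonalˡ (lincomb² ys)
      (λ x px → lincomb²-orthogonalʳ x (λ y py → isoX x y px py) ys pys) xs pxs

infixr 7 _∩²_
_∩²_ : Subset² n → Subset² n → Subset² n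
(S ∩² T) v = S v × T v

≐²-refl : {S : Subset² n} → S ≐² S
≐²-refl = (λ _ s → s) , (λ _ s → s)

≐²-sym : {S T : Subset² n} → S ≐² T → T ≐² S
≐²-sym (S⊆T , T⊆S) = T⊆S , S⊆T

≐²-trans : {S T U : Subset² n} → S ≐² T → T ≐² U → S ≐² U
≐²-trans (S⊆T , T⊆S) (T⊆U , U⊆T) = (λ v → T⊆U v ∘ S⊆T v) , (λ v → T⊆S v ∘ U⊆T v)

≐²-setoid : ℕ → Setoid (lsuc 0ℓ) 0ℓ
≐²-setoid n = record
  { Carrier = Subset² n ; _≈_ = _≐²_
  ; isEquivalence = record { refl = ≐²-refl ; sym = ≐²-sym ; trans = ≐²-trans } }

module ≐²-Reasoning {n : ℕ} = Relation.Binary.Reasoning.Setoid (≐²-setoid n)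

≐²-resp : {S S' T T' : Subset² n} → S ≐² S' → T ≐² T' → (S ≐² T) ⇔ (S' ≐² T')
≐²-resp S≐S' T≐T' = mk⇔ (λ S≐T → ≐²-trans (≐²-sym S≐S') (≐²-trans S≐T T≐T'))
                        (λ S'≐T' → ≐²-trans S≐S' (≐²-trans S'≐T' (≐²-sym T≐T')))

∩²-cong : {S S' T T' : Subset² n} → S ≐² S' → T ≐² T' → (S ∩² T) ≐² (S' ∩² T')
∩²-cong (S⊆S' , S'⊆S) (T⊆T' , T'⊆T) =
  (λ { v (s , t) → S⊆S' v s , T⊆T' v t }) , (λ { v (s , t) → S'⊆S v s , T'⊆T v t })

∈Span : {S : Subset² n} → ∀ x → S x → Span S x
∈Span (x₁ , x₂) sx = (1ℚ , (x₁ , x₂)) ∷ [] , sx ∷ [] ,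
  sym (cong₂ _,_ (trans (+ᵥ-identityʳ _) (·ᵥ-identityˡ x₁)) (trans (+ᵥ-identityʳ _) (·ᵥ-identityˡ x₂)))

Span-mono : {S T : Subset² n} → S ⊆² T → Span S ⊆² Span T
Span-mono S⊆T _ (xs , sxs , refl) = xs , All.map (λ {p} → S⊆T (proj₂ p)) sxs , refl

Span-cong : {S T : Subset² n} → S ≐² T → Span S ≐² Span T
Span-cong (S⊆T , T⊆S) = Span-mono S⊆T , Span-mono T⊆S

module _ {A₁ A₂ : Mat n n} (σ₁ : Isometry A₁ A₁) (σ₂ : Isometry A₂ A₂) where

  img²-mono : {S T : Subset² n} → S ⊆² T → img² σ₁ σ₂ S ⊆² img² σ₁ σ₂ T
  img²-mono S⊆T _ (v , sv , eq₁ , eq₂) = v , S⊆T v sv , eq₁ , eq₂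

  img²-cong : {S T : Subset² n} → S ≐² T → img² σ₁ σ₂ S ≐² img² σ₁ σ₂ T
  img²-cong (S⊆T , T⊆S) = img²-mono S⊆T , img²-mono T⊆S

  img²⇒preimage : {S : Subset² n} → ∀ w → img² σ₁ σ₂ S w → S (apply² (inv σ₁) (inv σ₂) w)
  img²⇒preimage {S} _ ((v₁ , v₂) , sv , refl , refl) =
    subst S (sym (cong₂ _,_ (inv-l σ₁ v₁) (inv-l σ₂ v₂))) sv

  preimage⇒img² : {S : Subset² n} → ∀ w → S (apply² (inv σ₁) (inv σ₂) w) → img² σ₁ σ₂ S w
  preimage⇒img² (w₁ , w₂) s = _ , s , sym (inv-r σ₁ w₁) , sym (inv-r σ₂ w₂)

  img²-∩² : {S T : Subset² n} → img² σ₁ σ₂ (S ∩² T) ≐² (img² σ₁ σ₂ S ∩² img² σ₁ σ₂ T)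
  img²-∩² = (λ { _ (v , (s , t) , eq₁ , eq₂) → (v , s , eq₁ , eq₂) , (v , t , eq₁ , eq₂) })
          , (λ { w (s , t) → preimage⇒img² w (img²⇒preimage w s , img²⇒preimage w t) })

  -- ⊆ pulls the combination back along (σ₁⁻¹, σ₂⁻¹), ⊇ pushes it forward along (σ₁, σ₂).
  Span-img² : {S : Subset² n} → Span (img² σ₁ σ₂ S) ≐² img² σ₁ σ₂ (Span S)
  Span-img² = (λ { _ (xs , ixs , refl) → preimage⇒img² _
                  ( List.map (map₂ (apply² (inv σ₁) (inv σ₂))) xs
                  , map⁺ (All.map (λ {p} → img²⇒preimage (proj₂ p)) ixs)
                  , apply²-lincomb² (inv σ₁) (inv σ₂) xs ) })
            , (λ { _ (_ , (ys , sys , refl) , refl , refl) →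
                    List.map (map₂ (apply² (mat σ₁) (mat σ₂))) ys
                  , map⁺ (All.map (λ {p} s → proj₂ p , s , refl , refl) sys)
                  , apply²-lincomb² (mat σ₁) (mat σ₂) ys })

  img²-LatSum : {L₁ L₂ : Lattice n} → PreservesSet σ₁ ⟪ L₁ ⟫ → PreservesSet σ₂ ⟪ L₂ ⟫ →
                img² σ₁ σ₂ (LatSum L₁ L₂) ≐² LatSum L₁ L₂
  img²-LatSum (to₁ , from₁) (to₂ , from₂) =
      (λ { _ ((v₁ , v₂) , (l₁ , l₂) , refl , refl) → to₁ v₁ l₁ , to₂ v₂ l₂ })
    , (λ { w (l₁ , l₂) → preimage⇒img² w (from₁ _ l₁ , from₂ _ l₂) })

Intertwines : {B₁ B₂ : Mat n n} → Isometry B₁ B₁ → Isometry B₂ B₂ → Mat n n → Mat n n → Set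
Intertwines σ₁ σ₂ φ φ̂ = ∀ v → ⟦ σ₂ ⟧ (apply φ (⟦ σ₁ ⟧⁻¹ v)) ≡ apply φ̂ v

Graph-img²⇔Intertwines : {A₁ A₂ : Mat n n} (σ₁ : Isometry A₁ A₁) (σ₂ : Isometry A₂ A₂) (φ φ̂ : Mat n n) →
                         (Graph φ̂ ≐² img² σ₁ σ₂ (Graph φ)) ⇔ Intertwines σ₁ σ₂ φ φ̂
Graph-img²⇔Intertwines σ₁ σ₂ φ φ̂ = mk⇔ to from
  where
  open ≡-Reasoning
  to : Graph φ̂ ≐² img² σ₁ σ₂ (Graph φ) → Intertwines σ₁ σ₂ φ φ̂
  to (Ĝ⊆σG , _) v = begin
    ⟦ σ₂ ⟧ (apply φ (⟦ σ₁ ⟧⁻¹ v))          ≡⟨ cong ⟦ σ₂ ⟧ (img²⇒preimage σ₁ σ₂ _ (Ĝ⊆σG (v , apply φ̂ v) refl)) ⟨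
    ⟦ σ₂ ⟧ (⟦ σ₂ ⟧⁻¹ (apply φ̂ v))          ≡⟨ inv-r σ₂ _ ⟩
    apply φ̂ v                              ∎
  from : Intertwines σ₁ σ₂ φ φ̂ → Graph φ̂ ≐² img² σ₁ σ₂ (Graph φ)
  from σ₂φ≡φ̂σ₁ =
      (λ { (w₁ , w₂) refl → preimage⇒img² σ₁ σ₂ _ (begin
            ⟦ σ₂ ⟧⁻¹ (apply φ̂ w₁)                              ≡⟨ cong ⟦ σ₂ ⟧⁻¹ (σ₂φ≡φ̂σ₁ w₁) ⟨
            ⟦ σ₂ ⟧⁻¹ (⟦ σ₂ ⟧ (apply φ (⟦ σ₁ ⟧⁻¹ w₁)))          ≡⟨ inv-l σ₂ _ ⟩
            apply φ (⟦ σ₁ ⟧⁻¹ w₁)                              ∎) })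
    , (λ { _ ((v₁ , _) , refl , refl , refl) → begin
            ⟦ σ₂ ⟧ (apply φ v₁)                                ≡⟨ cong (⟦ σ₂ ⟧ ∘ apply φ) (inv-l σ₁ v₁) ⟨
            ⟦ σ₂ ⟧ (apply φ (⟦ σ₁ ⟧⁻¹ (⟦ σ₁ ⟧ v₁)))             ≡⟨ σ₂φ≡φ̂σ₁ (⟦ σ₁ ⟧ v₁) ⟩
            apply φ̂ (⟦ σ₁ ⟧ v₁)                               ∎ })

Graph-isSubmodule : (φ : Mat n n) → IsSubmodule (Graph φ)
Graph-isSubmodule φ = record
  { has-zero = sym (apply-zero φ)
  ; closed-+ = λ v₂≡φv₁ w₂≡φw₁ → trans (cong₂ _+ᵥ_ v₂≡φv₁ w₂≡φw₁) (sym (apply-+ φ _ _))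
  ; closed-ℤ = λ z v₂≡φv₁ → trans (cong (ι z ·ᵥ_) v₂≡φv₁) (sym (apply-· φ (ι z) _))
  }

LatSum-isSubmodule : (L₁ L₂ : Lattice n) → IsSubmodule (LatSum L₁ L₂)
LatSum-isSubmodule L₁ L₂ = record
  { has-zero = ∈L-zero L₁ , ∈L-zero L₂
  ; closed-+ = λ (v₁∈ , v₂∈) (w₁∈ , w₂∈) → ∈L-+ L₁ v₁∈ w₁∈ , ∈L-+ L₂ v₂∈ w₂∈
  ; closed-ℤ = λ z (v₁∈ , v₂∈) → ∈L-ℤ· L₁ z v₁∈ , ∈L-ℤ· L₂ z v₂∈
  }

∩²-isSubmodule : {S T : Subset² n} → IsSubmodule S → IsSubmodule T → IsSubmodule (S ∩² T)
∩²-isSubmodule S T = record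
  { has-zero = S.has-zero , T.has-zero
  ; closed-+ = λ (s , t) (s' , t') → S.closed-+ s s' , T.closed-+ t t'
  ; closed-ℤ = λ z (s , t) → S.closed-ℤ z s , T.closed-ℤ z t
  }
  where
  module S = IsSubmodule S
  module T = IsSubmodule T

maxTI⇒≐Graph∩LatSum : {A₁ A₂ : Mat n n} {L₁ L₂ : Lattice n} {X : Subset² n} {φ : Mat n n} →
                      IsMaxTISubmodule A₁ A₂ (LatSum L₁ L₂) X → Span X ≐² Graph φ →
                      X ≐² (Graph φ ∩² LatSum L₁ L₂)
maxTI⇒≐Graph∩LatSum {A₁ = A₁} {A₂} {L₁} {L₂} {X} {φ} ((_ , X⊆Λ , isoX) , maximal) (ℚX⊆G , G⊆ℚX) =
  X⊆G∩Λ , maximal (Graph φ ∩² LatSum L₁ L₂) G∩Λ-isTISubmodule X⊆G∩Λ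
  where
  X⊆G∩Λ : X ⊆² (Graph φ ∩² LatSum L₁ L₂)
  X⊆G∩Λ x x∈X = ℚX⊆G x (∈Span x x∈X) , X⊆Λ x x∈X
  G∩Λ-isTISubmodule : IsTISubmodule A₁ A₂ (LatSum L₁ L₂) (Graph φ ∩² LatSum L₁ L₂)
  G∩Λ-isTISubmodule =
      ∩²-isSubmodule (Graph-isSubmodule φ) (LatSum-isSubmodule L₁ L₂)
    , (λ _ → proj₂)
    , (λ x y (x∈G , _) (y∈G , _) → Span-isTotallyIsotropic A₁ A₂ isoX x y (G⊆ℚX x x∈G) (G⊆ℚX y y∈G))

module _ {A₁ A₂ : Mat n n} {X X̂ : Subset² n} {φ φ̂ : Mat n n}
         (ℚX≐Gφ : Span X ≐² Graph φ) (ℚX̂≐Gφ̂ : Span X̂ ≐² Graph φ̂)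
         (σ₁ : Isometry A₁ A₁) (σ₂ : Isometry A₂ A₂) where

  Span-img²⇔Intertwines : (Span X̂ ≐² img² σ₁ σ₂ (Span X)) ⇔ Intertwines σ₁ σ₂ φ φ̂
  Span-img²⇔Intertwines =
    ⇔.trans (≐²-resp ℚX̂≐Gφ̂ (img²-cong σ₁ σ₂ ℚX≐Gφ)) (Graph-img²⇔Intertwines σ₁ σ₂ φ φ̂)

  img²⇒Intertwines : X̂ ≐² img² σ₁ σ₂ X → Intertwines σ₁ σ₂ φ φ̂
  img²⇒Intertwines X̂≐σX =
    Equivalence.to Span-img²⇔Intertwines (≐²-trans (Span-cong X̂≐σX) (Span-img² σ₁ σ₂))

  Intertwines⇒img² : {L₁ L₂ : Lattice n} →
                     IsMaxTISubmodule A₁ A₂ (LatSum L₁ L₂) X → IsMaxTISubmodule A₁ A₂ (LatSum L₁ L₂) X̂ →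
                     PreservesSet σ₁ ⟪ L₁ ⟫ → PreservesSet σ₂ ⟪ L₂ ⟫ →
                     Intertwines σ₁ σ₂ φ φ̂ → X̂ ≐² img² σ₁ σ₂ X
  Intertwines⇒img² {L₁} {L₂} maxX maxX̂ σ₁Λ₁ σ₂Λ₂ σ₂φ≡φ̂σ₁ = begin
    X̂                                                   ≈⟨ maxTI⇒≐Graph∩LatSum {L₁ = L₁} {L₂} maxX̂ ℚX̂≐Gφ̂ ⟩
    Graph φ̂ ∩² LatSum L₁ L₂                             ≈⟨ ∩²-cong Ĝ≐σG (≐²-sym (img²-LatSum σ₁ σ₂ {L₁} {L₂} σ₁Λ₁ σ₂Λ₂)) ⟩
    img² σ₁ σ₂ (Graph φ) ∩² img² σ₁ σ₂ (LatSum L₁ L₂)   ≈⟨ img²-∩² σ₁ σ₂ ⟨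
    img² σ₁ σ₂ (Graph φ ∩² LatSum L₁ L₂)                ≈⟨ img²-cong σ₁ σ₂ (maxTI⇒≐Graph∩LatSum {L₁ = L₁} {L₂} maxX ℚX≐Gφ) ⟨
    img² σ₁ σ₂ X                                        ∎
    where
    open ≐²-Reasoning
    Ĝ≐σG : Graph φ̂ ≐² img² σ₁ σ₂ (Graph φ)
    Ĝ≐σG = Equivalence.from (Graph-img²⇔Intertwines σ₁ σ₂ φ φ̂) σ₂φ≡φ̂σ₁

module _ {A₁ A₂ Aw : Mat n n} (Σ₁ : Isometry A₁ Aw) (Σ₂ : Isometry A₂ Aw) (φ φ̂ : Mat n n) where
  open ≡-Reasoning

  Intertwines⇒double-coset : (σ₁ : Isometry A₁ A₁) (σ₂ : Isometry A₂ A₂) → Intertwines σ₁ σ₂ φ φ̂ →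
    ∀ w → ⟦ Σ₂ ⟧ (apply φ̂ (⟦ Σ₁ ⟧⁻¹ w))
        ≡ ⟦ conj Σ₂ σ₂ ⟧ (⟦ Σ₂ ⟧ (apply φ (⟦ Σ₁ ⟧⁻¹ (⟦ conj Σ₁ (invᴵ σ₁) ⟧ w))))
  Intertwines⇒double-coset σ₁ σ₂ σ₂φ≡φ̂σ₁ w = sym (begin
    ⟦ conj Σ₂ σ₂ ⟧ (⟦ Σ₂ ⟧ (apply φ (⟦ Σ₁ ⟧⁻¹ w₁)))             ≡⟨ ⟦conj⟧ Σ₂ σ₂ _ ⟩
    ⟦ Σ₂ ⟧ (⟦ σ₂ ⟧ (⟦ Σ₂ ⟧⁻¹ (⟦ Σ₂ ⟧ (apply φ (⟦ Σ₁ ⟧⁻¹ w₁))))) ≡⟨ cong (⟦ Σ₂ ⟧ ∘ ⟦ σ₂ ⟧) (inv-l Σ₂ _) ⟩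
    ⟦ Σ₂ ⟧ (⟦ σ₂ ⟧ (apply φ (⟦ Σ₁ ⟧⁻¹ w₁)))                     ≡⟨ cong (⟦ Σ₂ ⟧ ∘ ⟦ σ₂ ⟧ ∘ apply φ ∘ ⟦ Σ₁ ⟧⁻¹) (⟦conj⟧ Σ₁ (invᴵ σ₁) w) ⟩
    ⟦ Σ₂ ⟧ (⟦ σ₂ ⟧ (apply φ (⟦ Σ₁ ⟧⁻¹ (⟦ Σ₁ ⟧ v))))             ≡⟨ cong (⟦ Σ₂ ⟧ ∘ ⟦ σ₂ ⟧ ∘ apply φ) (inv-l Σ₁ v) ⟩
    ⟦ Σ₂ ⟧ (⟦ σ₂ ⟧ (apply φ (⟦ σ₁ ⟧⁻¹ (⟦ Σ₁ ⟧⁻¹ w))))           ≡⟨ cong ⟦ Σ₂ ⟧ (σ₂φ≡φ̂σ₁ (⟦ Σ₁ ⟧⁻¹ w)) ⟩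
    ⟦ Σ₂ ⟧ (apply φ̂ (⟦ Σ₁ ⟧⁻¹ w))                              ∎)
    where
    w₁ v : Vect n
    w₁ = ⟦ conj Σ₁ (invᴵ σ₁) ⟧ w
    v = ⟦ σ₁ ⟧⁻¹ (⟦ Σ₁ ⟧⁻¹ w)

  double-coset⇒Intertwines : (τ₁ τ₂ : Isometry Aw Aw) →
    (∀ w → ⟦ Σ₂ ⟧ (apply φ̂ (⟦ Σ₁ ⟧⁻¹ w)) ≡ ⟦ τ₂ ⟧ (⟦ Σ₂ ⟧ (apply φ (⟦ Σ₁ ⟧⁻¹ (⟦ τ₁ ⟧ w))))) →
    Intertwines (conj (invᴵ Σ₁) (invᴵ τ₁)) (conj (invᴵ Σ₂) τ₂) φ φ̂
  double-coset⇒Intertwines τ₁ τ₂ Σ₂φ̂Σ₁⁻¹≡τ₂Σ₂φΣ₁⁻¹τ₁ v = begin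
    ⟦ conj (invᴵ Σ₂) τ₂ ⟧ (apply φ (⟦ conj (invᴵ Σ₁) (invᴵ τ₁) ⟧⁻¹ v))
      ≡⟨ ⟦conj⟧ (invᴵ Σ₂) τ₂ _ ⟩
    ⟦ Σ₂ ⟧⁻¹ (⟦ τ₂ ⟧ (⟦ Σ₂ ⟧ (apply φ (⟦ conj (invᴵ Σ₁) (invᴵ τ₁) ⟧⁻¹ v))))
      ≡⟨ cong (⟦ Σ₂ ⟧⁻¹ ∘ ⟦ τ₂ ⟧ ∘ ⟦ Σ₂ ⟧ ∘ apply φ) (⟦conj⟧⁻¹ (invᴵ Σ₁) (invᴵ τ₁) v) ⟩
    ⟦ Σ₂ ⟧⁻¹ (⟦ τ₂ ⟧ (⟦ Σ₂ ⟧ (apply φ (⟦ Σ₁ ⟧⁻¹ (⟦ τ₁ ⟧ (⟦ Σ₁ ⟧ v))))))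
      ≡⟨ cong ⟦ Σ₂ ⟧⁻¹ (Σ₂φ̂Σ₁⁻¹≡τ₂Σ₂φΣ₁⁻¹τ₁ (⟦ Σ₁ ⟧ v)) ⟨
    ⟦ Σ₂ ⟧⁻¹ (⟦ Σ₂ ⟧ (apply φ̂ (⟦ Σ₁ ⟧⁻¹ (⟦ Σ₁ ⟧ v))))
      ≡⟨ inv-l Σ₂ _ ⟩
    apply φ̂ (⟦ Σ₁ ⟧⁻¹ (⟦ Σ₁ ⟧ v))
      ≡⟨ cong (apply φ̂) (inv-l Σ₁ v) ⟩
    apply φ̂ v ∎

proposition4p7 :
    (m : ℕ) (A₁ A₂ : Mat (2 * m) (2 * m)) → IsSymplectic A₁ → IsSymplectic A₂ →
    (L₁ L₂ : Lattice (2 * m)) → IsIntegralOn A₁ L₁ → IsIntegralOn A₂ L₂ →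
    (N₁ N₂ : ℕ) → IsLevel A₁ L₁ N₁ → IsLevel A₂ L₂ N₂ → SquareFree N₁ → SquareFree N₂ →
    (X X̂ : Subset² (2 * m)) →
    IsMaxTISubmodule A₁ A₂ (LatSum L₁ L₂) X → IsMaxTISubmodule A₁ A₂ (LatSum L₁ L₂) X̂ →
    NonDegOn A₁ (π₁ X) → NonDegOn A₂ (π₂ X) → NonDegOn A₁ (π₁ X̂) → NonDegOn A₂ (π₂ X̂) →
    (φ φ̂ : Mat (2 * m) (2 * m)) → Span X ≐² Graph φ → Span X̂ ≐² Graph φ̂ →
    (Aw : Mat (2 * m) (2 * m)) → IsSymplectic Aw →
    (Σ₁ : Isometry A₁ Aw) (Σ₂ : Isometry A₂ Aw) →
    ((σ₁ : Isometry A₁ A₁) (σ₂ : Isometry A₂ A₂) →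
      (Span X̂ ≐² img² σ₁ σ₂ (Span X))
        ⇔ (∀ v → ⟦ σ₂ ⟧ (apply φ (⟦ σ₁ ⟧⁻¹ v)) ≡ apply φ̂ v))
    ×
    ((Σ (Isometry A₁ A₁) λ σ₁ → Σ (Isometry A₂ A₂) λ σ₂ →
        PreservesSet σ₁ ⟪ L₁ ⟫ × PreservesSet σ₂ ⟪ L₂ ⟫ × (X̂ ≐² img² σ₁ σ₂ X))
      ⇔ (Σ (Isometry Aw Aw) λ τ₂ → Σ (Isometry Aw Aw) λ τ₁ →
          PreservesSet τ₂ (img Σ₂ ⟪ L₂ ⟫) × PreservesSet τ₁ (img Σ₁ ⟪ L₁ ⟫) ×
          (∀ w → ⟦ Σ₂ ⟧ (apply φ̂ (⟦ Σ₁ ⟧⁻¹ w))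
                   ≡ ⟦ τ₂ ⟧ (⟦ Σ₂ ⟧ (apply φ (⟦ Σ₁ ⟧⁻¹ (⟦ τ₁ ⟧ w)))))))
proposition4p7 _ _ _ _ _ L₁ L₂ _ _ _ _ _ _ _ _ X X̂ maxX maxX̂ _ _ _ _ φ φ̂ ℚX≐Gφ ℚX̂≐Gφ̂ _ _ Σ₁ Σ₂ =
  Span-img²⇔Intertwines ℚX≐Gφ ℚX̂≐Gφ̂ , mk⇔
    (λ { (σ₁ , σ₂ , σ₁Λ₁ , σ₂Λ₂ , X̂≐σX) →
           conj Σ₂ σ₂ , conj Σ₁ (invᴵ σ₁)
         , PreservesSet-conj Σ₂ σ₂ σ₂Λ₂ , PreservesSet-conj Σ₁ (invᴵ σ₁) (PreservesSet-invᴵ σ₁ σ₁Λ₁)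
         , Intertwines⇒double-coset Σ₁ Σ₂ φ φ̂ σ₁ σ₂ (img²⇒Intertwines ℚX≐Gφ ℚX̂≐Gφ̂ σ₁ σ₂ X̂≐σX) })
    (λ { (τ₂ , τ₁ , τ₂Λ₂ , τ₁Λ₁ , Σφ̂≡τΣφτ) →
         let σ₁ = conj (invᴵ Σ₁) (invᴵ τ₁)
             σ₂ = conj (invᴵ Σ₂) τ₂
             σ₁Λ₁ = PreservesSet-unconj Σ₁ (invᴵ τ₁) (PreservesSet-invᴵ τ₁ τ₁Λ₁)
             σ₂Λ₂ = PreservesSet-unconj Σ₂ τ₂ τ₂Λ₂
         in σ₁ , σ₂ , σ₁Λ₁ , σ₂Λ₂
          , Intertwines⇒img² ℚX≐Gφ ℚX̂≐Gφ̂ σ₁ σ₂ {L₁} {L₂} maxX maxX̂ σ₁Λ₁ σ₂Λ₂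
              (double-coset⇒Intertwines Σ₁ Σ₂ φ φ̂ τ₁ τ₂ Σφ̂≡τΣφτ) })
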